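{- Let the edges of $K_n$ be colored arbitrarily red or blue. Then no vertex $x\in V(K_n)$ is both red violated and blue violated in $K_n$. Moreover, if $w,x$ is a red (respectively blue) violated pair in $K_n$ and $y$ is a blue (respectively red) violated vertex in $K_n$, then the edges $\{w,y\}$ and $\{x,y\}$ have different colors.
   Context: A red (blue) path is a path all of whose edges are red (blue). A vertex $x$ is red (blue) violated in $K_n$ if there is a vertex $y$ such that there is no red (blue) $x$–$y$ path in $K_n$ with at most two edges. A pair $\{x,y\}$ of vertices with $x\ne y$ is a red (blue) violated pair in $K_n$ if there is no red (blue) path in $K_n$ joining $x$ and $y$ with at most two edges. -}

module Defs where

open import Data.Nat using (ℕ)
open import Data.Fin using (Fin)
open import Data.Product using (Σ; _×_; ∃)
open import Data.Sum using (_⊎_)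
open import Relation.Binary.PropositionalEquality using (_≡_)
open import Relation.Nullary using (¬_)

data Colour : Set where
  red blue : Colour

-- Values on the
-- diagonal (x , x) are irrelevant (loops are not edges) and never used.
record Colouring (n : ℕ) : Set where
  field
    col  : Fin n → Fin n → Colour
    symm : ∀ x y → col x y ≡ col y x
open Colouring public

data Path≤2 {n : ℕ} (c : Colouring n) (k : Colour) (x y : Fin n) : Set where
  len0 : x ≡ y → Path≤2 c k x y
  len1 : ¬ x ≡ y → col c x y ≡ k → Path≤2 c k x y
  len2 : (z : Fin n) → ¬ x ≡ z → ¬ z ≡ y → ¬ x ≡ y →
         col c x z ≡ k → col c z y ≡ k → Path≤2 c k x y

Violated : {n : ℕ} → Colouring n → Colour → Fin n → Set
Violated c k x = ∃ λ y → ¬ Path≤2 c k x y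

ViolatedPair : {n : ℕ} → Colouring n → Colour → Fin n → Fin n → Set
ViolatedPair c k x y = ¬ x ≡ y × ¬ Path≤2 c k x y

other : Colour → Colour
other red  = blue
other blue = red

-- Both parts rest on one observation: if y has no k-path of length ≤ 2 to v,
-- then every k-neighbour a of y differs from v and the edge av has the other
-- colour.  A vertex that is k-violated and (other k)-violated would thus be
-- joined to its two witnesses by edges of both colours, and the edge between
-- the witnesses closes a path of length two that should not exist.  For the
-- second part, y ∉ {w, x} (else y would be k-violated as well), the equal
-- edges wy and xy cannot both be k (that gives a k-path w y x), so both are
-- (other k); then w and x are both k-joined to the witness of y, giving a
-- k-path between w and x.
module Submission where

open import Defs
open import Data.Nat using (ℕ)
open import Data.Fin using (Fin; _≟_)
open import Data.Product using (_×_; _,_)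
open import Data.Sum using (_⊎_; inj₁; inj₂)
open import Data.Empty using (⊥-elim)
open import Relation.Binary.PropositionalEquality
  using (_≡_; _≢_; refl; sym; trans; ≢-sym)
open import Relation.Nullary using (¬_; yes; no)

other-involutive : ∀ k → other (other k) ≡ k
other-involutive red  = refl
other-involutive blue = refl

≡other-other⇒≡ : ∀ {k d} → d ≡ other (other k) → d ≡ k
≡other-other⇒≡ {k} e = trans e (other-involutive k)

≡-or-≡other : ∀ k d → d ≡ k ⊎ d ≡ other k
≡-or-≡other red  red  = inj₁ refl
≡-or-≡other red  blue = inj₂ refl
≡-or-≡other blue red  = inj₂ refl
≡-or-≡other blue blue = inj₁ refl

module _ {n : ℕ} (c : Colouring n) where

  col-sym : ∀ {k} {a b : Fin n} → col c a b ≡ k → col c b a ≡ k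
  col-sym {a = a} {b} e = trans (symm c b a) e

  Path≤2-sym : ∀ {k} {a b : Fin n} → Path≤2 c k a b → Path≤2 c k b a
  Path≤2-sym (len0 e)             = len0 (sym e)
  Path≤2-sym (len1 ne e)          = len1 (≢-sym ne) (col-sym e)
  Path≤2-sym (len2 z p q r e₁ e₂) =
    len2 z (≢-sym q) (≢-sym p) (≢-sym r) (col-sym e₂) (col-sym e₁)

  ¬Path≤2⇒≢ : ∀ {k} {a b : Fin n} → ¬ Path≤2 c k a b → a ≢ b
  ¬Path≤2⇒≢ np e = np (len0 e)

  ¬Path≤2⇒col≡other : ∀ {k} {a b : Fin n} → ¬ Path≤2 c k a b → col c a b ≡ other k
  ¬Path≤2⇒col≡other {k} {a} {b} np with ≡-or-≡other k (col c a b)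
  ... | inj₁ e = ⊥-elim (np (len1 (¬Path≤2⇒≢ np) e))
  ... | inj₂ e = e

  ¬Path≤2⇒neighbour-col≡other : ∀ {k} {y a v : Fin n} → ¬ Path≤2 c k y v →
    y ≢ a → col c y a ≡ k → a ≢ v × col c a v ≡ other k
  ¬Path≤2⇒neighbour-col≡other {k} {y} {a} {v} np y≢a ya with a ≟ v
  ... | yes refl = ⊥-elim (np (len1 y≢a ya))
  ... | no a≢v with ≡-or-≡other k (col c a v)
  ...   | inj₁ av = ⊥-elim (np (len2 a y≢a a≢v (¬Path≤2⇒≢ np) ya av))
  ...   | inj₂ av = a≢v , av

  Violated⇒¬Violated-other : ∀ k (x : Fin n) →
    Violated c k x → ¬ Violated c (other k) x
  Violated⇒¬Violated-other k x (y , np-xy) (z , np-xz)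
    with ¬Path≤2⇒neighbour-col≡other np-xz (¬Path≤2⇒≢ np-xy) (¬Path≤2⇒col≡other np-xy)
  ... | y≢z , yz =
    np-xy (len2 z (¬Path≤2⇒≢ np-xz) (≢-sym y≢z) (¬Path≤2⇒≢ np-xy)
                  (≡other-other⇒≡ (¬Path≤2⇒col≡other np-xz)) (col-sym (≡other-other⇒≡ yz)))

  ViolatedPair⇒col-other : ∀ k {w x y : Fin n} → ViolatedPair c k w x →
    y ≢ w → y ≢ x → col c w y ≡ col c x y → col c y w ≡ other k × col c y x ≡ other k
  ViolatedPair⇒col-other k {w} {x} {y} (w≢x , np) y≢w y≢x wy≡xy
    with ≡-or-≡other k (col c w y)
  ... | inj₁ wy = ⊥-elim (np (len2 y (≢-sym y≢w) y≢x w≢x wy (col-sym (trans (sym wy≡xy) wy))))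
  ... | inj₂ wy = col-sym wy , col-sym (trans (sym wy≡xy) wy)

  ViolatedPair-Violated-other⇒col≢ : ∀ k (w x y : Fin n) → ViolatedPair c k w x →
    Violated c (other k) y → col c w y ≢ col c x y
  ViolatedPair-Violated-other⇒col≢ k w x y (w≢x , np) (v , np-yv) wy≡xy
    with y ≟ w | y ≟ x
  ... | yes refl | _ = Violated⇒¬Violated-other k y (x , np) (v , np-yv)
  ... | no _ | yes refl = Violated⇒¬Violated-other k y (w , λ p → np (Path≤2-sym p)) (v , np-yv)
  ... | no y≢w | no y≢x
    with ViolatedPair⇒col-other k (w≢x , np) y≢w y≢x wy≡xy
  ...   | yw , yx
    with ¬Path≤2⇒neighbour-col≡other np-yv y≢w yw | ¬Path≤2⇒neighbour-col≡other np-yv y≢x yx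
  ...     | w≢v , wv | x≢v , xv =
    np (len2 v w≢v (≢-sym x≢v) w≢x (≡other-other⇒≡ wv) (col-sym (≡other-other⇒≡ xv)))

lemma1 : (n : ℕ) (c : Colouring n) →
         ((x : Fin n) → ¬ (Violated c red x × Violated c blue x)) ×
         ((k : Colour) (w x y : Fin n) → ViolatedPair c k w x →
           Violated c (other k) y → ¬ col c w y ≡ col c x y)
lemma1 n c =
  (λ x (red-x , blue-x) → Violated⇒¬Violated-other c red x red-x blue-x) ,
  ViolatedPair-Violated-other⇒col≢ c
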